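{- (Conservation for nuclei in logic.) Let $\vdash$ be $\vdash_p$ plus additional axioms, let $j$ be a nucleus on $\vdash$, and let $\vdash_*$ be $\vdash$ plus additional axioms such that ${\vdash_*}\subseteq{\vdash^j}$. (i) In propositional logic the following are equivalent: (a) for all finite sets of formulas $\Gamma$ and formulas $\varphi$, $\Gamma\vdash^j\varphi$ iff $\Gamma\vdash_* j\varphi$; (b) $\varphi\to j\psi\vdash_* j(\varphi\to\psi)$ for all formulas $\varphi,\psi$. (ii) Let $\vdash^Q$, $\vdash_*^Q$, $\vdash^{Qj}$ be $\vdash$, $\vdash_*$, $\vdash^j$ plus quantifiers (and let $j$ be a nucleus on $\vdash^Q$). If $j$ is compatible with substitution, then the following are equivalent in predicate logic: (a) for all $\Gamma,\varphi$, $\Gamma\vdash^{Qj}\varphi$ iff $\Gamma\vdash_*^Q j\varphi$; (b) $\varphi\to j\psi\vdash_*^Q j(\varphi\to\psi)$ and $\forall x\, j\varphi\vdash_*^Q j\forall x\varphi$ for all formulas $\varphi,\psi$ and variables $x$.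
   Context: $S$ is a set of propositional (resp. first-order predicate) formulas containing $\top,\bot$ and closed under $\vee,\wedge,\to,\neg$ (and, in the predicate case, under $\forall,\exists$). An entailment relation on $S$ is a relation ${\rhd}\subseteq\mathrm{Fin}(S)\times S$ (finite sets of formulas on the left) satisfying: (R) if $\varphi\in\Gamma$ then $\Gamma\rhd\varphi$; (T) if $\Gamma\rhd\psi$ and $\Gamma',\psi\rhd\varphi$ then $\Gamma,\Gamma'\rhd\varphi$; (M) if $\Gamma\rhd\varphi$ then $\Gamma,\Gamma'\rhd\varphi$ (commas denote union). Positive logic $\vdash_p$ is the least entailment relation $\rhd$ satisfying rule R$\to$ (if $\Gamma,\varphi\rhd\psi$ then $\Gamma\rhd\varphi\to\psi$) and the axioms $\varphi,\psi\rhd\varphi\wedge\psi$; $\varphi\wedge\psi\rhd\varphi$; $\varphi\wedge\psi\rhd\psi$; $\varphi\rhd\varphi\vee\psi$; $\psi\rhd\varphi\vee\psi$; $\varphi\vee\psi,\varphi\to\delta,\psi\to\delta\rhd\delta$; $\varphi,\varphi\to\psi\rhd\psi$; $\emptyset\rhd\top$. For an inductively generated entailment relation, "plus additional axioms" means the least entailment relation satisfying its generating axioms and rules and the new axioms. "Plus quantifiers" means adding to the inductive definition the rules: L$\forall$: from $\varphi[t/x],\Gamma,\forall x\varphi\rhd\delta$ infer $\Gamma,\forall x\varphi\rhd\delta$; R$\forall$: from $\Gamma\rhd\varphi[y/x]$ infer $\Gamma\rhd\forall x\varphi$; L$\exists$: from $\Gamma,\varphi[y/x]\rhd\delta$ infer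 $\Gamma,\exists x\varphi\rhd\delta$; R$\exists$: from $\Gamma\rhd\varphi[t/x]$ infer $\Gamma\rhd\exists x\varphi$; with $y$ fresh in R$\forall$ and L$\exists$. A nucleus on $\rhd$ is a map $j\colon S\to S$ with (L$j$) if $\Gamma,\varphi\rhd j\psi$ then $\Gamma,j\varphi\rhd j\psi$, and (R$j$) if $\Gamma\rhd\psi$ then $\Gamma\rhd j\psi$. $\vdash^j$ is $\vdash$ plus the stability axioms $j\varphi\vdash^j\varphi$ for all $\varphi$. $j$ is compatible with substitution if $j(\varphi[t/x])\equiv(j\varphi)[t/x]$. -}

module Defs where

open import Data.Nat using (ℕ; zero; suc)
open import Data.Bool using (Bool; true; false)
open import Data.List using (List; []; _∷_; _++_; map)
open import Data.List.Membership.Propositional using (_∈_)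
open import Data.List.Relation.Binary.Subset.Propositional using (_⊆_)
open import Data.Vec using (Vec; []; _∷_)
open import Data.Sum using (_⊎_)
open import Relation.Binary.PropositionalEquality using (_≡_)

-- Finite sets of formulas are represented by lists; the structural rule
-- M is stated with list inclusion, so every relation below is invariant
-- under the set-equality of contexts (order / duplicates irrelevant).

-- a relation  Fin(S) × S  (also used for sets of additional axioms)
Ent : Set → Set₁
Ent F = List F → F → Set

_∪ᴬ_ : {F : Set} → Ent F → Ent F → Ent F
(Ax ∪ᴬ Ax′) Γ φ = Ax Γ φ ⊎ Ax′ Γ φ

data Stab {F : Set} (j : F → F) : Ent F where
  stab : ∀ {φ} → Stab j (j φ ∷ []) φ

_⊆ᴱ_ : {F : Set} → Ent F → Ent F → Set
R ⊆ᴱ R′ = ∀ {Γ φ} → R Γ φ → R′ Γ φ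

record IsNucleus {F : Set} (_▷_ : Ent F) (j : F → F) : Set where
  field
    Lj : ∀ Γ φ ψ → (φ ∷ Γ) ▷ j ψ → (j φ ∷ Γ) ▷ j ψ
    Rj : ∀ Γ ψ → Γ ▷ ψ → Γ ▷ j ψ

data PForm (A : Set) : Set where
  atom : A → PForm A
  ⊤ ⊥ : PForm A
  _∧_ _∨_ _⇒_ : PForm A → PForm A → PForm A
  ¬_ : PForm A → PForm A

infixr 6 _∧_
infixr 5 _∨_
infixr 4 _⇒_

-- PDer Ax  =  ⊢_p plus the additional axioms Ax
-- (least entailment relation satisfying R, T, M, R→, the axioms of ⊢_p and Ax)
data PDer {A : Set} (Ax : Ent (PForm A)) : Ent (PForm A) where
  ax   : ∀ {Γ φ} → Ax Γ φ → PDer Ax Γ φ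
  R    : ∀ {Γ φ} → φ ∈ Γ → PDer Ax Γ φ
  T    : ∀ {Γ Γ′ ψ φ} → PDer Ax Γ ψ → PDer Ax (ψ ∷ Γ′) φ → PDer Ax (Γ ++ Γ′) φ
  M    : ∀ {Γ Γ′ φ} → Γ ⊆ Γ′ → PDer Ax Γ φ → PDer Ax Γ′ φ
  R⇒   : ∀ {Γ φ ψ} → PDer Ax (φ ∷ Γ) ψ → PDer Ax Γ (φ ⇒ ψ)
  ∧I   : ∀ {φ ψ} → PDer Ax (φ ∷ ψ ∷ []) (φ ∧ ψ)
  ∧E₁  : ∀ {φ ψ} → PDer Ax ((φ ∧ ψ) ∷ []) φ
  ∧E₂  : ∀ {φ ψ} → PDer Ax ((φ ∧ ψ) ∷ []) ψ
  ∨I₁  : ∀ {φ ψ} → PDer Ax (φ ∷ []) (φ ∨ ψ)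
  ∨I₂  : ∀ {φ ψ} → PDer Ax (ψ ∷ []) (φ ∨ ψ)
  ∨E   : ∀ {φ ψ δ} → PDer Ax ((φ ∨ ψ) ∷ (φ ⇒ δ) ∷ (ψ ⇒ δ) ∷ []) δ
  MP   : ∀ {φ ψ} → PDer Ax (φ ∷ (φ ⇒ ψ) ∷ []) ψ
  ⊤I   : PDer Ax [] ⊤

record Sig : Set₁ where
  field
    Fun Rel : Set
    funAr : Fun → ℕ
    relAr : Rel → ℕ
open Sig

data Term (S : Sig) : Set where
  var : ℕ → Term S
  fn  : (f : Fun S) → Vec (Term S) (funAr S f) → Term S

data Form (S : Sig) : Set where
  rel : (r : Rel S) → Vec (Term S) (relAr S r) → Form S
  ⊤ ⊥ : Form S
  _∧_ _∨_ _⇒_ : Form S → Form S → Form S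
  ¬_ : Form S → Form S
  ∀′ ∃′ : Form S → Form S     -- binds de Bruijn index 0

module _ {S : Sig} where
  mutual
    renT : (ℕ → ℕ) → Term S → Term S
    renT ρ (var x) = var (ρ x)
    renT ρ (fn f ts) = fn f (renTs ρ ts)

    renTs : ∀ {n} → (ℕ → ℕ) → Vec (Term S) n → Vec (Term S) n
    renTs ρ [] = []
    renTs ρ (t ∷ ts) = renT ρ t ∷ renTs ρ ts

  mutual
    subT : (ℕ → Term S) → Term S → Term S
    subT σ (var x) = σ x
    subT σ (fn f ts) = fn f (subTs σ ts)

    subTs : ∀ {n} → (ℕ → Term S) → Vec (Term S) n → Vec (Term S) n
    subTs σ [] = []
    subTs σ (t ∷ ts) = subT σ t ∷ subTs σ ts

  lift : (ℕ → Term S) → ℕ → Term S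
  lift σ zero = var zero
  lift σ (suc n) = renT suc (σ n)

  sub : (ℕ → Term S) → Form S → Form S
  sub σ (rel r ts) = rel r (subTs σ ts)
  sub σ ⊤ = ⊤
  sub σ ⊥ = ⊥
  sub σ (φ ∧ ψ) = sub σ φ ∧ sub σ ψ
  sub σ (φ ∨ ψ) = sub σ φ ∨ sub σ ψ
  sub σ (φ ⇒ ψ) = sub σ φ ⇒ sub σ ψ
  sub σ (¬ φ) = ¬ sub σ φ
  sub σ (∀′ φ) = ∀′ (sub (lift σ) φ)
  sub σ (∃′ φ) = ∃′ (sub (lift σ) φ)

  shift : Form S → Form S
  shift = sub (λ n → var (suc n))

  _◂_ : Term S → (ℕ → Term S)
  (t ◂ zero) = t
  (t ◂ suc n) = var n

  _[_]₀ : Form S → Term S → Form S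
  φ [ t ]₀ = sub (t ◂_) φ

  -- j compatible with substitution (syntactic identity, i.e. up to α)
  CompatSub : (Form S → Form S) → Set
  CompatSub j = ∀ (σ : ℕ → Term S) (φ : Form S) → j (sub σ φ) ≡ sub σ (j φ)

-- QDer q Ax : ⊢_p plus the axioms Ax on predicate formulas;
-- if q ≡ true additionally "plus quantifiers".
data QDer {S : Sig} (q : Bool) (Ax : Ent (Form S)) : Ent (Form S) where
  ax   : ∀ {Γ φ} → Ax Γ φ → QDer q Ax Γ φ
  R    : ∀ {Γ φ} → φ ∈ Γ → QDer q Ax Γ φ
  T    : ∀ {Γ Γ′ ψ φ} → QDer q Ax Γ ψ → QDer q Ax (ψ ∷ Γ′) φ → QDer q Ax (Γ ++ Γ′) φ
  M    : ∀ {Γ Γ′ φ} → Γ ⊆ Γ′ → QDer q Ax Γ φ → QDer q Ax Γ′ φ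
  R⇒   : ∀ {Γ φ ψ} → QDer q Ax (φ ∷ Γ) ψ → QDer q Ax Γ (φ ⇒ ψ)
  ∧I   : ∀ {φ ψ} → QDer q Ax (φ ∷ ψ ∷ []) (φ ∧ ψ)
  ∧E₁  : ∀ {φ ψ} → QDer q Ax ((φ ∧ ψ) ∷ []) φ
  ∧E₂  : ∀ {φ ψ} → QDer q Ax ((φ ∧ ψ) ∷ []) ψ
  ∨I₁  : ∀ {φ ψ} → QDer q Ax (φ ∷ []) (φ ∨ ψ)
  ∨I₂  : ∀ {φ ψ} → QDer q Ax (ψ ∷ []) (φ ∨ ψ)
  ∨E   : ∀ {φ ψ δ} → QDer q Ax ((φ ∨ ψ) ∷ (φ ⇒ δ) ∷ (ψ ⇒ δ) ∷ []) δ
  MP   : ∀ {φ ψ} → QDer q Ax (φ ∷ (φ ⇒ ψ) ∷ []) ψ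
  ⊤I   : QDer q Ax [] ⊤
  -- quantifier rules (de Bruijn: "y fresh" = shift the context)
  L∀   : ∀ {Γ φ δ t} → q ≡ true →
         QDer q Ax (φ [ t ]₀ ∷ ∀′ φ ∷ Γ) δ → QDer q Ax (∀′ φ ∷ Γ) δ
  R∀   : ∀ {Γ φ} → q ≡ true →
         QDer q Ax (map shift Γ) φ → QDer q Ax Γ (∀′ φ)
  L∃   : ∀ {Γ φ δ} → q ≡ true →
         QDer q Ax (φ ∷ map shift Γ) (shift δ) → QDer q Ax (∃′ φ ∷ Γ) δ
  R∃   : ∀ {Γ φ t} → q ≡ true →
         QDer q Ax Γ (φ [ t ]₀) → QDer q Ax Γ (∃′ φ)

-- Direction (b) ⇒ (a) translates Γ ⊢ʲ φ into Γ ⊢* j φ by induction on the derivation.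
-- Rules and axioms of ⊢ survive by R j, and the stability axiom becomes j φ ⊢* j φ.
-- Cut needs L j for ⊢*, which follows from (b) and the nucleus law j (φ → ψ), j φ ⊢ j ψ;
-- →- and ∀-introduction need exactly the commutations in (b), and L∃ needs j to commute
-- with substitution. The converse of the translation is cut with j φ ⊢ʲ φ.
-- Direction (a) ⇒ (b) applies (a) to φ → j ψ ⊢ʲ φ → ψ and ∀x j φ ⊢ʲ ∀x φ, which both
-- hold by stability.
module Submission where

open import Defs
open import Data.Bool using (Bool; true; false)
open import Data.List using (List; []; _∷_; _++_; map)
open import Data.List.Properties using (++-identityʳ)
open import Data.List.Relation.Binary.Subset.Propositional using (_⊆_)
open import Data.List.Relation.Binary.Subset.Propositional.Properties using (⊆-reflexive-↭; xs⊆xs++ys)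
open import Data.List.Relation.Binary.Permutation.Propositional using (_↭_; ↭-refl; ↭-swap)
open import Data.List.Relation.Binary.Permutation.Propositional.Properties using (++-comm)
open import Data.List.Relation.Unary.Any using (here)
open import Data.Nat using (ℕ; zero; suc)
open import Data.Product using (_×_; _,_)
open import Data.Sum using (inj₁; inj₂)
open import Data.Vec using (Vec) renaming ([] to []ᵛ; _∷_ to _∷ᵛ_)
open import Function using (id; _∘_)
open import Function.Bundles using (_⇔_; mk⇔; Equivalence)
open import Relation.Binary.PropositionalEquality using (_≡_; refl; trans; cong; cong₂; subst; sym)

record IsEntailment {F : Set} (_⇒_ : F → F → F) (_▷_ : Ent F) : Set where
  field
    cut          : ∀ {Γ Γ′ ψ φ} → Γ ▷ ψ → (ψ ∷ Γ′) ▷ φ → (Γ ++ Γ′) ▷ φ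
    weaken       : ∀ {Γ Γ′ φ} → Γ ⊆ Γ′ → Γ ▷ φ → Γ′ ▷ φ
    ⇒-intro      : ∀ {Γ φ ψ} → (φ ∷ Γ) ▷ ψ → Γ ▷ (φ ⇒ ψ)
    modus-ponens : ∀ {φ ψ} → (φ ∷ (φ ⇒ ψ) ∷ []) ▷ ψ

  cut₁ : ∀ {Γ ψ φ} → Γ ▷ ψ → (ψ ∷ []) ▷ φ → Γ ▷ φ
  cut₁ {Γ} p q = subst (_▷ _) (++-identityʳ Γ) (cut p q)

  permute : ∀ {Γ Γ′ φ} → Γ ↭ Γ′ → Γ ▷ φ → Γ′ ▷ φ
  permute = weaken ∘ ⊆-reflexive-↭

module NucleusProperties {F : Set} {_⇒_ : F → F → F} {_▷_ : Ent F}
  (ent : IsEntailment _⇒_ _▷_) {j : F → F} (nucleus : IsNucleus _▷_ j) where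
  open IsEntailment ent
  open IsNucleus nucleus

  j-map : ∀ {Γ φ ψ} → (φ ∷ Γ) ▷ ψ → (j φ ∷ Γ) ▷ j ψ
  j-map = Lj _ _ _ ∘ Rj _ _

  j-modus-ponens : ∀ {φ ψ} → (j (φ ⇒ ψ) ∷ j φ ∷ []) ▷ j ψ
  j-modus-ponens = Lj _ _ _ (permute (↭-swap _ _ ↭-refl) (j-map modus-ponens))

-- ▷ is the base calculus ⊢, ▷* the extension ⊢_* and ▷ʲ the stable extension ⊢^j.
module Conservation {F : Set} {_⇒_ : F → F → F} (j : F → F)
  {_▷_ _▷*_ _▷ʲ_ : Ent F}
  (▷-ent : IsEntailment _⇒_ _▷_) (▷*-ent : IsEntailment _⇒_ _▷*_)
  (▷ʲ-ent : IsEntailment _⇒_ _▷ʲ_)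
  (nucleus : IsNucleus _▷_ j)
  (▷⊆▷* : _▷_ ⊆ᴱ _▷*_) (▷*⊆▷ʲ : _▷*_ ⊆ᴱ _▷ʲ_)
  (stable : ∀ {φ} → (j φ ∷ []) ▷ʲ φ) where
  open IsNucleus nucleus
  open NucleusProperties ▷-ent nucleus
  open IsEntailment ▷*-ent
  module ▷ʲ = IsEntailment ▷ʲ-ent

  Conservative : Set
  Conservative = ∀ Γ φ → Γ ▷ʲ φ ⇔ Γ ▷* j φ

  ⇒-Commutes : Set
  ⇒-Commutes = ∀ φ ψ → ((φ ⇒ j ψ) ∷ []) ▷* j (φ ⇒ ψ)

  ▷⇒▷*j : ∀ {Γ φ} → Γ ▷ φ → Γ ▷* j φ
  ▷⇒▷*j = ▷⊆▷* ∘ Rj _ _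

  j-map-▷* : ∀ {Γ φ ψ} → (φ ∷ Γ) ▷ ψ → (j φ ∷ Γ) ▷* j ψ
  j-map-▷* = ▷⊆▷* ∘ j-map

  ▷*j⇒▷ʲ : ∀ {Γ φ} → Γ ▷* j φ → Γ ▷ʲ φ
  ▷*j⇒▷ʲ p = ▷ʲ.cut₁ (▷*⊆▷ʲ p) stable

  Lj-▷* : ⇒-Commutes → ∀ {Γ ψ φ} → (ψ ∷ Γ) ▷* j φ → (j ψ ∷ Γ) ▷* j φ
  Lj-▷* commutes {Γ} {ψ} {φ} p =
    permute (++-comm Γ _) (cut (cut₁ (⇒-intro p) (commutes ψ φ)) (▷⊆▷* j-modus-ponens))

  conservative⇒commutes : Conservative → ⇒-Commutes
  conservative⇒commutes conservative φ ψ = Equivalence.to (conservative _ _)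
    (▷ʲ.⇒-intro (▷ʲ.cut₁ ▷ʲ.modus-ponens stable))

  translation⇒conservative : (∀ {Γ φ} → Γ ▷ʲ φ → Γ ▷* j φ) → Conservative
  translation⇒conservative translate Γ φ = mk⇔ translate ▷*j⇒▷ʲ

PDer-isEntailment : ∀ {A} {Ax : Ent (PForm A)} → IsEntailment _⇒_ (PDer Ax)
PDer-isEntailment = record
  { cut = T ; weaken = M ; ⇒-intro = R⇒ ; modus-ponens = MP }

QDer-isEntailment : ∀ {S} {q} {Ax : Ent (Form S)} → IsEntailment _⇒_ (QDer q Ax)
QDer-isEntailment = record
  { cut = T ; weaken = M ; ⇒-intro = R⇒ ; modus-ponens = MP }

PDer-map : ∀ {A} {Ax Ax′ : Ent (PForm A)} → Ax ⊆ᴱ PDer Ax′ → PDer Ax ⊆ᴱ PDer Ax′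
PDer-map f (ax a) = f a
PDer-map f (R m) = R m
PDer-map f (T p q) = T (PDer-map f p) (PDer-map f q)
PDer-map f (M s p) = M s (PDer-map f p)
PDer-map f (R⇒ p) = R⇒ (PDer-map f p)
PDer-map f ∧I = ∧I
PDer-map f ∧E₁ = ∧E₁
PDer-map f ∧E₂ = ∧E₂
PDer-map f ∨I₁ = ∨I₁
PDer-map f ∨I₂ = ∨I₂
PDer-map f ∨E = ∨E
PDer-map f MP = MP
PDer-map f ⊤I = ⊤I

QDer-map : ∀ {S} {q q′ : Bool} {Ax Ax′ : Ent (Form S)} →
           (q ≡ true → q′ ≡ true) → Ax ⊆ᴱ QDer q′ Ax′ → QDer q Ax ⊆ᴱ QDer q′ Ax′
QDer-map e f (ax a) = f a
QDer-map e f (R m) = R m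
QDer-map e f (T p q) = T (QDer-map e f p) (QDer-map e f q)
QDer-map e f (M s p) = M s (QDer-map e f p)
QDer-map e f (R⇒ p) = R⇒ (QDer-map e f p)
QDer-map e f ∧I = ∧I
QDer-map e f ∧E₁ = ∧E₁
QDer-map e f ∧E₂ = ∧E₂
QDer-map e f ∨I₁ = ∨I₁
QDer-map e f ∨I₂ = ∨I₂
QDer-map e f ∨E = ∨E
QDer-map e f MP = MP
QDer-map e f ⊤I = ⊤I
QDer-map e f (L∀ x p) = L∀ (e x) (QDer-map e f p)
QDer-map e f (R∀ x p) = R∀ (e x) (QDer-map e f p)
QDer-map e f (L∃ x p) = L∃ (e x) (QDer-map e f p)
QDer-map e f (R∃ x p) = R∃ (e x) (QDer-map e f p)

QDer-⊆ᴱ-quantifiers : ∀ {S} {Ax Ax′ : Ent (Form S)} →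
                      QDer false Ax ⊆ᴱ QDer false Ax′ → QDer true Ax ⊆ᴱ QDer true Ax′
QDer-⊆ᴱ-quantifiers incl = QDer-map id (QDer-map (λ ()) ax ∘ incl ∘ ax)

module _ {S : Sig} where
  mutual
    subT-lift-renT : ∀ (σ : ℕ → Term S) t →
                     subT (lift σ) (renT suc t) ≡ renT suc (subT σ t)
    subT-lift-renT σ (var x) = refl
    subT-lift-renT σ (fn f ts) = cong (fn f) (subTs-lift-renTs σ ts)

    subTs-lift-renTs : ∀ {n} (σ : ℕ → Term S) (ts : Vec (Term S) n) →
                       subTs (lift σ) (renTs suc ts) ≡ renTs suc (subTs σ ts)
    subTs-lift-renTs σ []ᵛ = refl
    subTs-lift-renTs σ (t ∷ᵛ ts) = cong₂ _∷ᵛ_ (subT-lift-renT σ t) (subTs-lift-renTs σ ts)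

  LeftInverse : (σ τ : ℕ → Term S) → Set
  LeftInverse σ τ = ∀ n → subT σ (τ n) ≡ var n

  lift-leftInverse : ∀ {σ τ} → LeftInverse σ τ → LeftInverse (lift σ) (lift τ)
  lift-leftInverse inv zero = refl
  lift-leftInverse {σ} {τ} inv (suc n) =
    trans (subT-lift-renT σ (τ n)) (cong (renT suc) (inv n))

  mutual
    subT-leftInverse : ∀ {σ τ} → LeftInverse σ τ → ∀ t → subT σ (subT τ t) ≡ t
    subT-leftInverse inv (var x) = inv x
    subT-leftInverse inv (fn f ts) = cong (fn f) (subTs-leftInverse inv ts)

    subTs-leftInverse : ∀ {n σ τ} → LeftInverse σ τ →
                        ∀ (ts : Vec (Term S) n) → subTs σ (subTs τ ts) ≡ ts
    subTs-leftInverse inv []ᵛ = refl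
    subTs-leftInverse inv (t ∷ᵛ ts) =
      cong₂ _∷ᵛ_ (subT-leftInverse inv t) (subTs-leftInverse inv ts)

  sub-leftInverse : ∀ {σ τ} → LeftInverse σ τ → ∀ φ → sub σ (sub τ φ) ≡ φ
  sub-leftInverse inv (rel r ts) = cong (rel r) (subTs-leftInverse inv ts)
  sub-leftInverse inv ⊤ = refl
  sub-leftInverse inv ⊥ = refl
  sub-leftInverse inv (φ ∧ ψ) = cong₂ _∧_ (sub-leftInverse inv φ) (sub-leftInverse inv ψ)
  sub-leftInverse inv (φ ∨ ψ) = cong₂ _∨_ (sub-leftInverse inv φ) (sub-leftInverse inv ψ)
  sub-leftInverse inv (φ ⇒ ψ) = cong₂ _⇒_ (sub-leftInverse inv φ) (sub-leftInverse inv ψ)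
  sub-leftInverse inv (¬ φ) = cong ¬_ (sub-leftInverse inv φ)
  sub-leftInverse inv (∀′ φ) = cong ∀′ (sub-leftInverse (lift-leftInverse inv) φ)
  sub-leftInverse inv (∃′ φ) = cong ∃′ (sub-leftInverse (lift-leftInverse inv) φ)

  -- shift (∀′ ψ) = ∀′ (sub (lift _) ψ); instantiating that body at the bound variable undoes the shift.
  instantiate-shifted-body : ∀ φ → sub (lift (λ n → var (suc n))) φ [ var zero ]₀ ≡ φ
  instantiate-shifted-body = sub-leftInverse inverse
    where
    inverse : LeftInverse (var zero ◂_) (lift (λ n → var (suc n)))
    inverse zero = refl
    inverse (suc n) = refl

module Propositional {A : Set} (Ax Ax* : Ent (PForm A)) (j : PForm A → PForm A)
  (nucleus : IsNucleus (PDer Ax) j)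
  (⊢*⊆⊢ʲ : PDer (Ax ∪ᴬ Ax*) ⊆ᴱ PDer (Ax ∪ᴬ Stab j)) where
  open Conservation j PDer-isEntailment PDer-isEntailment PDer-isEntailment nucleus
    (PDer-map (λ a → ax (inj₁ a))) ⊢*⊆⊢ʲ (ax (inj₂ stab))
  open IsEntailment (PDer-isEntailment {Ax = Ax ∪ᴬ Ax*}) using (cut₁)

  module _ (commutes : ⇒-Commutes) where
    translate : ∀ {Γ φ} → PDer (Ax ∪ᴬ Stab j) Γ φ → PDer (Ax ∪ᴬ Ax*) Γ (j φ)
    translate (ax (inj₁ a)) = ▷⇒▷*j (ax a)
    translate (ax (inj₂ stab)) = R (here refl)
    translate (R m) = ▷⇒▷*j (R m)
    translate (T p q) = T (translate p) (Lj-▷* commutes (translate q))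
    translate (M s p) = M s (translate p)
    translate (R⇒ p) = cut₁ (R⇒ (translate p)) (commutes _ _)
    translate ∧I = ▷⇒▷*j ∧I
    translate ∧E₁ = ▷⇒▷*j ∧E₁
    translate ∧E₂ = ▷⇒▷*j ∧E₂
    translate ∨I₁ = ▷⇒▷*j ∨I₁
    translate ∨I₂ = ▷⇒▷*j ∨I₂
    translate ∨E = ▷⇒▷*j ∨E
    translate MP = ▷⇒▷*j MP
    translate ⊤I = ▷⇒▷*j ⊤I

  conservative⇔⇒-commutes : Conservative ⇔ ⇒-Commutes
  conservative⇔⇒-commutes =
    mk⇔ conservative⇒commutes (translation⇒conservative ∘ translate)

module Predicate {S : Sig} (Ax Ax* : Ent (Form S)) (j : Form S → Form S)
  (nucleus : IsNucleus (QDer true Ax) j) (compatible : CompatSub j)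
  (⊢*⊆⊢ʲ : QDer true (Ax ∪ᴬ Ax*) ⊆ᴱ QDer true (Ax ∪ᴬ Stab j)) where
  open Conservation j QDer-isEntailment QDer-isEntailment QDer-isEntailment nucleus
    (QDer-map id (λ a → ax (inj₁ a))) ⊢*⊆⊢ʲ (ax (inj₂ stab))
  open IsEntailment (QDer-isEntailment {q = true} {Ax = Ax ∪ᴬ Ax*}) using (cut₁)

  ∀-Commutes : Set
  ∀-Commutes = ∀ φ → QDer true (Ax ∪ᴬ Ax*) (∀′ (j φ) ∷ []) (j (∀′ φ))

  conservative⇒∀-commutes : Conservative → ∀-Commutes
  conservative⇒∀-commutes conservative φ =
    Equivalence.to (conservative _ _) (R∀ refl (L∀ {t = var zero} refl instance-stable))
    where
    instance-stable : QDer true (Ax ∪ᴬ Stab j) (_ ∷ map shift (∀′ (j φ) ∷ [])) φ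
    instance-stable = M (xs⊆xs++ys _ _)
      (subst (λ ψ → QDer true _ (ψ ∷ []) φ) (sym (instantiate-shifted-body (j φ)))
        (ax (inj₂ stab)))

  module _ (⇒-commutes : ⇒-Commutes) (∀-commutes : ∀-Commutes) where
    translate : ∀ {Γ φ} → QDer true (Ax ∪ᴬ Stab j) Γ φ → QDer true (Ax ∪ᴬ Ax*) Γ (j φ)
    translate (ax (inj₁ a)) = ▷⇒▷*j (ax a)
    translate (ax (inj₂ stab)) = R (here refl)
    translate (R m) = ▷⇒▷*j (R m)
    translate (T p q) = T (translate p) (Lj-▷* ⇒-commutes (translate q))
    translate (M s p) = M s (translate p)
    translate (R⇒ p) = cut₁ (R⇒ (translate p)) (⇒-commutes _ _)
    translate ∧I = ▷⇒▷*j ∧I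
    translate ∧E₁ = ▷⇒▷*j ∧E₁
    translate ∧E₂ = ▷⇒▷*j ∧E₂
    translate ∨I₁ = ▷⇒▷*j ∨I₁
    translate ∨I₂ = ▷⇒▷*j ∨I₂
    translate ∨E = ▷⇒▷*j ∨E
    translate MP = ▷⇒▷*j MP
    translate ⊤I = ▷⇒▷*j ⊤I
    translate (L∀ e p) = L∀ e (translate p)
    translate (R∀ e p) = cut₁ (R∀ e (translate p)) (∀-commutes _)
    translate (L∃ {φ = φ} {δ = δ} e p) =
      L∃ e (subst (QDer true _ (φ ∷ _)) (compatible _ δ) (translate p))
    translate (R∃ e p) = cut₁ (translate p) (j-map-▷* (R∃ e (R (here refl))))

  conservative⇔commutes : Conservative ⇔ (⇒-Commutes × ∀-Commutes)
  conservative⇔commutes = mk⇔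
    (λ conservative → conservative⇒commutes conservative , conservative⇒∀-commutes conservative)
    (λ (⇒-commutes , ∀-commutes) → translation⇒conservative (translate ⇒-commutes ∀-commutes))

theorem5p2 :
    (∀ (A : Set) (Ax Ax* : Ent (PForm A)) (j : PForm A → PForm A)
      → IsNucleus (PDer Ax) j
      → PDer (Ax ∪ᴬ Ax*) ⊆ᴱ PDer (Ax ∪ᴬ Stab j)
      → (∀ (Γ : List (PForm A)) (φ : PForm A)
            → PDer (Ax ∪ᴬ Stab j) Γ φ ⇔ PDer (Ax ∪ᴬ Ax*) Γ (j φ))
        ⇔ (∀ (φ ψ : PForm A) → PDer (Ax ∪ᴬ Ax*) ((φ ⇒ j ψ) ∷ []) (j (φ ⇒ ψ))))
    ×
    (∀ (S : Sig) (Ax Ax* : Ent (Form S)) (j : Form S → Form S)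
      → IsNucleus (QDer false Ax) j
      → QDer false (Ax ∪ᴬ Ax*) ⊆ᴱ QDer false (Ax ∪ᴬ Stab j)
      → IsNucleus (QDer true Ax) j
      → CompatSub j
      → (∀ (Γ : List (Form S)) (φ : Form S)
            → QDer true (Ax ∪ᴬ Stab j) Γ φ ⇔ QDer true (Ax ∪ᴬ Ax*) Γ (j φ))
        ⇔ ((∀ (φ ψ : Form S) → QDer true (Ax ∪ᴬ Ax*) ((φ ⇒ j ψ) ∷ []) (j (φ ⇒ ψ)))
           × (∀ (φ : Form S) → QDer true (Ax ∪ᴬ Ax*) (∀′ (j φ) ∷ []) (j (∀′ φ)))))
theorem5p2 =
    (λ A Ax Ax* j nucleus ⊢*⊆⊢ʲ → Propositional.conservative⇔⇒-commutes Ax Ax* j nucleus ⊢*⊆⊢ʲ)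
  , λ S Ax Ax* j _ ⊢*⊆⊢ʲ nucleus compatible →
      Predicate.conservative⇔commutes Ax Ax* j nucleus compatible (QDer-⊆ᴱ-quantifiers ⊢*⊆⊢ʲ)
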